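{- Every connected finite simple graph $G$ with at least $2$ vertices has a connecting transition set of size $|V(G)|-2$.
   Context: A transition is a set of two distinct adjacent edges $\{ab,bc\}$ with $a\neq c$, written $abc$. Given a set $T$ of transitions of $G$, a walk $(v_1,\dots,v_k)$ (consecutive vertices adjacent) is $T$-compatible if for every $i\in[1,k-2]$, either $v_iv_{i+1}v_{i+2}\in T$ or $v_i=v_{i+2}$. $T$ is a connecting transition set of $G$ if for all vertices $u,v$ of $G$ there is a $T$-compatible walk from $u$ to $v$. -}

module Defs where

open import Level using (Level; suc; _⊔_)
open import Data.Nat using (ℕ)
open import Data.Fin using (Fin)
open import Data.List using (List; []; _∷_; length)
open import Data.List.Relation.Unary.All using (All)
open import Data.List.Relation.Unary.AllPairs using (AllPairs)
open import Data.List.Membership.Propositional using (_∈_)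
open import Data.Product using (_×_; _,_; ∃-syntax)
open import Data.Sum using (_⊎_)
open import Data.Unit using (⊤)
open import Relation.Nullary using (¬_)
open import Relation.Binary.PropositionalEquality using (_≡_; _≢_)

record SimpleGraph (n : ℕ) : Set₁ where
  field
    Adj     : Fin n → Fin n → Set
    adj-sym : ∀ {u v} → Adj u v → Adj v u
    irrefl  : ∀ {u} → ¬ Adj u u

module _ {n : ℕ} (G : SimpleGraph n) where
  open SimpleGraph G

  Triple : Set
  Triple = Fin n × Fin n × Fin n

  -- (a , b , c) represents the transition abc = {ab, bc}: ab, bc edges and a ≠ c.
  IsTransition : Triple → Set
  IsTransition (a , b , c) = Adj a b × Adj b c × a ≢ c

  SameTransition : Triple → Triple → Set
  SameTransition (a , b , c) (a' , b' , c') =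
    (a ≡ a' × b ≡ b' × c ≡ c') ⊎ (a ≡ c' × b ≡ b' × c ≡ a')

  record TransitionSet : Set where
    field
      elems    : List Triple
      valid    : All IsTransition elems
      distinct : AllPairs (λ t t' → ¬ SameTransition t t') elems
  open TransitionSet public

  size : TransitionSet → ℕ
  size T = length (elems T)

  InT : TransitionSet → Fin n → Fin n → Fin n → Set
  InT T a b c = ∃[ t ] (t ∈ elems T × SameTransition (a , b , c) t)

  AdjSeq : List (Fin n) → Set
  AdjSeq (x ∷ y ∷ rest) = Adj x y × AdjSeq (y ∷ rest)
  AdjSeq _ = ⊤

  CompatSeq : TransitionSet → List (Fin n) → Set
  CompatSeq T (x ∷ y ∷ z ∷ rest) = (InT T x y z ⊎ x ≡ z) × CompatSeq T (y ∷ z ∷ rest)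
  CompatSeq T _ = ⊤

  lastOf : Fin n → List (Fin n) → Fin n
  lastOf x [] = x
  lastOf x (y ∷ ys) = lastOf y ys

  IsWalk : Fin n → Fin n → List (Fin n) → Set
  IsWalk u v ws = AdjSeq (u ∷ ws) × lastOf u ws ≡ v

  Connected : Set
  Connected = ∀ u v → ∃[ ws ] IsWalk u v ws

  CompatibleWalk : TransitionSet → Fin n → Fin n → List (Fin n) → Set
  CompatibleWalk T u v ws = IsWalk u v ws × CompatSeq T (u ∷ ws)

  IsConnectingTransitionSet : TransitionSet → Set
  IsConnectingTransitionSet T = ∀ u v → ∃[ ws ] CompatibleWalk T u v ws

-- Grow a vertex set S from an edge x₀y together with a transition set T, |T| = |S| - 2,
-- such that every u ∈ S has a T-compatible walk to x₀ whose last arc is y x₀.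
-- A vertex w ∉ S adjacent to some p ∈ S, whose walk continues p r …, is added with the
-- transition wpr; it is new because w is not an endpoint of any earlier transition.
-- Once S = V(G), the walk from u and the reverse of the walk from v meet in the
-- backtrack y x₀ y, which every transition set allows.
module Submission where

open import Defs
open import Data.Nat using (ℕ; zero; suc; _+_; _≤_; _<_; _∸_; s≤s; z≤n)
open import Data.Nat.Properties using (≤-refl; <⇒≤; n≮n; ≤⇒≯; +-cancelʳ-≡; +-comm)
open import Data.Fin using (Fin)
open import Data.Fin.Properties using (_≟_; all?; ¬∀⟶∃¬; injective⇒≤)
open import Data.List using (List; []; _∷_; length; lookup)
open import Data.List.Relation.Unary.All as All using (All; []; _∷_)
open import Data.List.Relation.Unary.All.Properties using (¬Any⇒All¬)
open import Data.List.Relation.Unary.Any using (here; there; index)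
open import Data.List.Relation.Unary.AllPairs using ([]; _∷_)
open import Data.List.Relation.Unary.Unique.Propositional using (Unique)
open import Data.List.Membership.Propositional using (_∈_; _∉_)
open import Data.List.Membership.Propositional.Properties using (∈-lookup)
open import Data.List.Membership.Setoid.Properties using (index-injective)
open import Data.Product using (_×_; ∃-syntax; Σ-syntax; _,_)
open import Data.Sum as Sum using (_⊎_; inj₁; inj₂)
open import Data.Empty using (⊥-elim)
open import Data.Unit using (tt)
open import Function.Definitions using (Injective)
open import Relation.Nullary using (¬_; yes; no; contradiction)
open import Relation.Unary using (Decidable)
open import Relation.Binary.PropositionalEquality
  using (_≡_; _≢_; refl; sym; trans; cong; subst; setoid)

Unique⇒lookup-injective : ∀ {A : Set} {xs : List A} → Unique xs → Injective _≡_ _≡_ (lookup xs)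
Unique⇒lookup-injective (_ ∷ _) {Fin.zero} {Fin.zero} _ = refl
Unique⇒lookup-injective (x∉ ∷ _) {Fin.zero} {Fin.suc j} eq =
  ⊥-elim (All.lookup x∉ (∈-lookup j) eq)
Unique⇒lookup-injective (x∉ ∷ _) {Fin.suc i} {Fin.zero} eq =
  ⊥-elim (All.lookup x∉ (∈-lookup i) (sym eq))
Unique⇒lookup-injective (_ ∷ u) {Fin.suc i} {Fin.suc j} eq =
  cong Fin.suc (Unique⇒lookup-injective u eq)

module _ {n : ℕ} where
  open import Data.List.Membership.DecPropositional (_≟_ {n}) using (_∈?_)

  Unique⇒length≤ : {xs : List (Fin n)} → Unique xs → length xs ≤ n
  Unique⇒length≤ u = injective⇒≤ (Unique⇒lookup-injective u)

  enumeration⇒length≥ : {xs : List (Fin n)} → (∀ x → x ∈ xs) → n ≤ length xs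
  enumeration⇒length≥ enum = injective⇒≤ (index-injective (setoid _) (enum _) (enum _))

  Unique∧length≡⇒enumeration : {xs : List (Fin n)} → Unique xs → length xs ≡ n → ∀ x → x ∈ xs
  Unique∧length≡⇒enumeration {xs} u len x with x ∈? xs
  ... | yes x∈ = x∈
  ... | no x∉ = contradiction (subst (_< n) len (Unique⇒length≤ (¬Any⇒All¬ xs x∉ ∷ u))) (n≮n n)

  length<⇒∃∉ : {xs : List (Fin n)} → length xs < n → ∃[ x ] x ∉ xs
  length<⇒∃∉ {xs} len with all? (_∈? xs)
  ... | yes enum = contradiction len (≤⇒≯ (enumeration⇒length≥ enum))
  ... | no ¬enum = ¬∀⟶∃¬ n (_∈ xs) (_∈? xs) ¬enum

module _ {n : ℕ} (G : SimpleGraph n) where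
  open SimpleGraph G

  private
    V : Set
    V = Fin n

  leaving-edge : ∀ {p} {P : V → Set p} → Decidable P → ∀ {a} ws → P a →
    AdjSeq G (a ∷ ws) → ¬ P (lastOf G a ws) → ∃[ u ] ∃[ w ] (P u × ¬ P w × Adj w u)
  leaving-edge P? [] Pa _ ¬Plast = contradiction Pa ¬Plast
  leaving-edge P? {a} (b ∷ ws) Pa (ab , adj) ¬Plast with P? b
  ... | yes Pb = leaving-edge P? ws Pb adj ¬Plast
  ... | no ¬Pb = a , b , Pa , ¬Pb , adj-sym ab

  InT-reverse : ∀ T {a b c} → InT G T a b c → InT G T c b a
  InT-reverse _ (t , t∈ , inj₁ (p , q , r)) = t , t∈ , inj₂ (r , q , p)
  InT-reverse _ (t , t∈ , inj₂ (p , q , r)) = t , t∈ , inj₁ (r , q , p)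

  -- ArcWalk R a b c d: a walk with first arc ab and last arc cd in which every three
  -- consecutive vertices either satisfy R or form a backtrack.
  data ArcWalk (R : V → V → V → Set) : V → V → V → V → Set where
    arc : ∀ {a b} → Adj a b → ArcWalk R a b a b
    _∷⟨_⟩_ : ∀ {x a b c d} → Adj x a → R x a b ⊎ x ≡ b → ArcWalk R a b c d → ArcWalk R x a c d

  module _ {R : V → V → V → Set} where
    first-arc : ∀ {a b c d} → ArcWalk R a b c d → Adj a b
    first-arc (arc ab) = ab
    first-arc (xa ∷⟨ _ ⟩ _) = xa

    snoc : ∀ {a b c d e} → ArcWalk R a b c d → R c d e ⊎ c ≡ e → Adj d e → ArcWalk R a b d e
    snoc (arc ab) k de = ab ∷⟨ k ⟩ arc de
    snoc (xa ∷⟨ k′ ⟩ w) k de = xa ∷⟨ k′ ⟩ snoc w k de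

    join : ∀ {a b c d e f g} → ArcWalk R a b c d → R c d e ⊎ c ≡ e → ArcWalk R d e f g →
      ArcWalk R a b f g
    join (arc ab) k w′ = ab ∷⟨ k ⟩ w′
    join (xa ∷⟨ k′ ⟩ w) k w′ = xa ∷⟨ k′ ⟩ join w k w′

    reverse : (∀ {a b c} → R a b c → R c b a) → ∀ {a b c d} → ArcWalk R a b c d → ArcWalk R d c b a
    reverse R-sym (arc ab) = arc (adj-sym ab)
    reverse R-sym (xa ∷⟨ k ⟩ w) = snoc (reverse R-sym w) (Sum.map R-sym sym k) (adj-sym xa)

    map : ∀ {R′} → (∀ {a b c} → R a b c → R′ a b c) → ∀ {a b c d} → ArcWalk R a b c d →
      ArcWalk R′ a b c d
    map f (arc ab) = arc ab
    map f (xa ∷⟨ k ⟩ w) = xa ∷⟨ Sum.map₁ f k ⟩ map f w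

    -- the vertices after the first one
    vertices : ∀ {a b c d} → ArcWalk R a b c d → List V
    vertices (arc {b = b} _) = b ∷ []
    vertices (_∷⟨_⟩_ {a = a} _ _ w) = a ∷ vertices w

    vertices-adjacent : ∀ {a b c d} (w : ArcWalk R a b c d) → AdjSeq G (a ∷ vertices w)
    vertices-adjacent (arc ab) = ab , tt
    vertices-adjacent (xa ∷⟨ _ ⟩ w) = xa , vertices-adjacent w

    vertices-last : ∀ {a b c d} (w : ArcWalk R a b c d) → lastOf G a (vertices w) ≡ d
    vertices-last (arc _) = refl
    vertices-last (_ ∷⟨ _ ⟩ w) = vertices-last w

  vertices-compatible : ∀ {T a b c d} (w : ArcWalk (InT G T) a b c d) →
    CompatSeq G T (a ∷ vertices w)
  vertices-compatible (arc _) = tt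
  vertices-compatible (_ ∷⟨ k ⟩ arc _) = k , tt
  vertices-compatible (_ ∷⟨ k ⟩ w@(_ ∷⟨ _ ⟩ _)) = k , vertices-compatible w

  compatible-walk : ∀ {T a b c d} → ArcWalk (InT G T) a b c d → ∃[ ws ] CompatibleWalk G T a d ws
  compatible-walk w = vertices w , (vertices-adjacent w , vertices-last w) , vertices-compatible w

  EndsIn : List V → Triple G → Set
  EndsIn S (a , _ , c) = a ∈ S × c ∈ S

  module Growth {x₀ y : V} (x₀y : Adj x₀ y) where
    open import Data.List.Membership.DecPropositional (_≟_ {n}) using (_∈?_)

    record Anchored : Set where
      field
        S        : List V
        unique   : Unique S
        T        : TransitionSet G
        size-T   : size G T + 2 ≡ length S
        ends-in  : All (EndsIn S) (elems T)
        x₀∈S     : x₀ ∈ S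
        anchored : ∀ {u} → u ∈ S → ∃[ r ] (r ∈ S × ArcWalk (InT G T) u r y x₀)

    initial : Anchored
    initial = record
      { S = y ∷ x₀ ∷ [] ; unique = (y≢x₀ ∷ []) ∷ [] ∷ [] ; T = ∅ ; size-T = refl
      ; ends-in = [] ; x₀∈S = there (here refl) ; anchored = anchored₀ }
      where
        y≢x₀ : y ≢ x₀
        y≢x₀ refl = irrefl x₀y
        ∅ : TransitionSet G
        ∅ = record { elems = [] ; valid = [] ; distinct = [] }
        anchored₀ : ∀ {u} → u ∈ y ∷ x₀ ∷ [] → ∃[ r ] (r ∈ y ∷ x₀ ∷ [] × ArcWalk (InT G ∅) u r y x₀)
        anchored₀ (here refl) = x₀ , there (here refl) , arc (adj-sym x₀y)
        anchored₀ (there (here refl)) = y , here refl , x₀y ∷⟨ inj₂ refl ⟩ arc (adj-sym x₀y)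

    fresh-transition : ∀ {S w p r} → w ∉ S → ∀ {t} → EndsIn S t → ¬ SameTransition G (w , p , r) t
    fresh-transition w∉ (a∈ , _) (inj₁ (refl , _ , _)) = w∉ a∈
    fresh-transition w∉ (_ , c∈) (inj₂ (refl , _ , _)) = w∉ c∈

    extend : (A : Anchored) → ∀ {w p} → w ∉ Anchored.S A → p ∈ Anchored.S A → Adj w p →
      Σ[ A′ ∈ Anchored ] length (Anchored.S A′) ≡ suc (length (Anchored.S A))
    extend A {w} {p} w∉ p∈ wp with Anchored.anchored A p∈
    ... | r , r∈ , walk = record
      { S = w ∷ S ; unique = ¬Any⇒All¬ S w∉ ∷ unique ; T = T′ ; size-T = cong suc size-T
      ; ends-in = (here refl , there r∈) ∷ All.map (Data.Product.map there there) ends-in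
      ; x₀∈S = there x₀∈S ; anchored = anchored′ } , refl
      where
        open Anchored A
        w≢r : w ≢ r
        w≢r refl = w∉ r∈
        T′ : TransitionSet G
        T′ = record { elems = (w , p , r) ∷ elems T
                    ; valid = (wp , first-arc walk , w≢r) ∷ valid T
                    ; distinct = All.map (fresh-transition w∉) ends-in ∷ distinct T }
        weaken : ∀ {a b c} → InT G T a b c → InT G T′ a b c
        weaken (t , t∈ , same) = t , there t∈ , same
        new : InT G T′ w p r
        new = (w , p , r) , here refl , inj₁ (refl , refl , refl)
        anchored′ : ∀ {u} → u ∈ w ∷ S → ∃[ r ] (r ∈ w ∷ S × ArcWalk (InT G T′) u r y x₀)
        anchored′ (here refl) = p , there p∈ , wp ∷⟨ inj₁ new ⟩ map weaken walk
        anchored′ (there u∈) with anchored u∈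
        ... | r′ , r′∈ , walk′ = r′ , there r′∈ , map weaken walk′

    enlarge : Connected G → (A : Anchored) → length (Anchored.S A) < n →
      Σ[ A′ ∈ Anchored ] length (Anchored.S A′) ≡ suc (length (Anchored.S A))
    enlarge conn A len<n with length<⇒∃∉ len<n
    ... | w , w∉ with conn x₀ w
    ... | ws , adj , refl with leaving-edge (_∈? Anchored.S A) ws (Anchored.x₀∈S A) adj w∉
    ... | p , w′ , p∈ , w′∉ , w′p = extend A w′∉ p∈ w′p

    grow : Connected G → ∀ k → 2 + k ≤ n → Σ[ A ∈ Anchored ] length (Anchored.S A) ≡ 2 + k
    grow conn zero _ = initial , refl
    grow conn (suc k) 3+k≤n with grow conn k (<⇒≤ 3+k≤n)
    ... | A , len with enlarge conn A (subst (_< n) (sym len) 3+k≤n)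
    ... | A′ , len′ = A′ , trans len′ (cong suc len)

    spanning⇒connecting : (A : Anchored) → length (Anchored.S A) ≡ n →
      IsConnectingTransitionSet G (Anchored.T A)
    spanning⇒connecting A len u v =
      let (_ , _ , to-anchor) = anchored (covers u)
          (_ , _ , from-anchor) = anchored (covers v)
      in compatible-walk (join to-anchor (inj₂ refl) (reverse (InT-reverse T) from-anchor))
      where
        open Anchored A
        covers : ∀ x → x ∈ S
        covers = Unique∧length≡⇒enumeration unique len

corollary2 : (n : ℕ) → 2 ≤ n → (G : SimpleGraph n) → Connected G →
    ∃[ T ] (IsConnectingTransitionSet G T × size G T ≡ n ∸ 2)
corollary2 (suc (suc m)) (s≤s (s≤s z≤n)) G conn with conn Fin.zero (Fin.suc Fin.zero)
... | [] , _ , ()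
... | _ ∷ _ , (x₀y , _) , _ with Growth.grow G x₀y conn m ≤-refl
... | A , len = T , spanning⇒connecting A len , +-cancelʳ-≡ 2 (size G T) m size-T≡m
  where
    open Growth G x₀y
    open Anchored A using (T; size-T)
    size-T≡m : size G T + 2 ≡ m + 2
    size-T≡m = trans size-T (trans len (+-comm 2 m))
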